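{- Let $n,m,k$ be positive integers and let $G'$ be a finite graph with $k \ge 2n + td(G') + td(P_m \times P_n)$. Let $B_{n,m,k}$ be the broom defined below (vertex-disjoint from $G'$), and let $G$ be the graph obtained from the disjoint union of $G'$ and $B_{n,m,k}$ by adding a nonempty set of edges, each joining a vertex of $V(G')$ to a vertex of $\{(i,1) \mid 1 \le i \le n\}$. For $1 \le i \le n$ let $V_i$ be the set consisting of the vertices $(i,j)$, $1\le j\le m$, together with the vertices of the path of $2^k-1$ vertices attached to $(i,m)$. Suppose there exist an optimal treedepth decomposition $T$ of $G$ and an integer $d \ge 1$ such that (1) there exists $1 \le j \le m$ with $top(T,d) \cap \{(i,j) \mid 1 \le i \le n\} = \emptyset$, and (2) for every $1 \le i \le n$, $V_i \cap top(T,d) \neq \emptyset$. Then $d \ge n$.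
   Context: $P_m \times P_n$ denotes the grid graph with vertex set $\{(i,j) \mid 1\le i\le n,\ 1\le j\le m\}$, where $(i,j)$ and $(i',j')$ are adjacent iff $|i-i'|+|j-j'|=1$. The broom $B_{n,m,k}$ is obtained from this grid by, for each $1\le i\le n$, adding a new path on $2^k-1$ vertices and an edge joining $(i,m)$ to one end of that path (these paths are pairwise disjoint). A treedepth decomposition of a graph $G$ is a rooted forest $T$ with $V(T)=V(G)$ such that for every edge $uv$ of $G$, one of $u,v$ is an ancestor of the other in $T$; its height is the maximum number of vertices on a root-to-leaf path; $td(G)$ is the minimum height over all treedepth decompositions, and a decomposition is optimal if its height equals $td(G)$. The depth of a root is $1$, and $top(T,d) := \{v \in V(T) \mid \text{depth of } v \text{ in } T \le d\}$. -}

module Defs where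

open import Data.Nat using (ℕ; zero; suc; _+_; _*_; _∸_; _^_; _≤_)
open import Data.Fin using (Fin; toℕ)
open import Data.Maybe using (Maybe; just; nothing)
open import Data.Product using (Σ; ∃; _×_; _,_)
open import Data.Sum using (_⊎_; inj₁; inj₂)
open import Relation.Binary.PropositionalEquality using (_≡_)
open import Relation.Nullary using (¬_)

record FinGraph : Set₁ where
  field
    size   : ℕ
    Adj    : Fin size → Fin size → Set
    sym    : ∀ {x y} → Adj x y → Adj y x
    irrefl : ∀ {x} → ¬ Adj x x

-- Rooted forests on a vertex type V.  `parent v = nothing` means v is a
-- root.  `depth` counts the vertices on the path from the root to v
-- (a root has depth 1); its defining equations force acyclicity.

record Forest (V : Set) : Set where
  field
    parent      : V → Maybe V
    depth       : V → ℕ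
    depth-root  : ∀ v → parent v ≡ nothing → depth v ≡ 1
    depth-child : ∀ v u → parent v ≡ just u → depth v ≡ suc (depth u)

open Forest public

data Anc {V : Set} (T : Forest V) : V → V → Set where
  par  : ∀ {u v} → parent T v ≡ just u → Anc T u v
  step : ∀ {u w v} → parent T v ≡ just w → Anc T u w → Anc T u v

IsTDDecomp : {V : Set} → (V → V → Set) → Forest V → Set
IsTDDecomp {V} E T = ∀ (u v : V) → E u v → Anc T u v ⊎ Anc T v u

HeightLE : {V : Set} → Forest V → ℕ → Set
HeightLE {V} T h = ∀ (v : V) → depth T v ≤ h

HasTDDecomp : {V : Set} → (V → V → Set) → ℕ → Set
HasTDDecomp {V} E h = Σ (Forest V) λ T → IsTDDecomp E T × HeightLE T h

IsTD : {V : Set} → (V → V → Set) → ℕ → Set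
IsTD E h = HasTDDecomp E h × (∀ h' → HasTDDecomp E h' → h ≤ h')

Optimal : {V : Set} → (V → V → Set) → Forest V → Set
Optimal {V} E T = IsTDDecomp E T × (∀ h → HasTDDecomp E h → HeightLE T h)

InTop : {V : Set} → Forest V → ℕ → V → Set
InTop T d v = depth T v ≤ d

-- Grid P_m × P_n : vertices (i , j), i : Fin n (rows 1..n),
-- j : Fin m (columns 1..m), 0-indexed.  Adjacent iff |i-i'|+|j-j'| = 1.

data GridAdj (n m : ℕ) : Fin n × Fin m → Fin n × Fin m → Set where
  horiz : ∀ {i j j'} → toℕ j' ≡ suc (toℕ j) → GridAdj n m (i , j) (i , j')
  vert  : ∀ {i i' j} → toℕ i' ≡ suc (toℕ i) → GridAdj n m (i , j) (i' , j)

GridEdge : (n m : ℕ) → Fin n × Fin m → Fin n × Fin m → Set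
GridEdge n m u v = GridAdj n m u v ⊎ GridAdj n m v u

-- Broom B_{n,m,k}: the grid plus, for each row i, a path on 2^k - 1
-- vertices (path i p, p : Fin (2^k - 1)), whose end p = 0 is joined to
-- (i , m) (0-indexed column m-1).

data BroomV (n m k : ℕ) : Set where
  grid : Fin n → Fin m → BroomV n m k
  path : Fin n → Fin (2 ^ k ∸ 1) → BroomV n m k

data BroomAdj (n m k : ℕ) : BroomV n m k → BroomV n m k → Set where
  gridE  : ∀ {i j i' j'} → GridAdj n m (i , j) (i' , j') →
           BroomAdj n m k (grid i j) (grid i' j')
  pathE  : ∀ {i p q} → toℕ q ≡ suc (toℕ p) →
           BroomAdj n m k (path i p) (path i q)
  attach : ∀ {i j p} → suc (toℕ j) ≡ m → toℕ p ≡ 0 →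
           BroomAdj n m k (grid i j) (path i p)

-- The graph G: disjoint union of G' and B_{n,m,k} plus the edges given
-- by X : X x i means x ∈ V(G') is joined to (i , 1).

GV : FinGraph → (n m k : ℕ) → Set
GV G' n m k = Fin (FinGraph.size G') ⊎ BroomV n m k

data GAdj (G' : FinGraph) (n m k : ℕ)
          (X : Fin (FinGraph.size G') → Fin n → Set) :
          GV G' n m k → GV G' n m k → Set where
  old   : ∀ {x y} → FinGraph.Adj G' x y → GAdj G' n m k X (inj₁ x) (inj₁ y)
  broom : ∀ {u v} → BroomAdj n m k u v → GAdj G' n m k X (inj₂ u) (inj₂ v)
  new   : ∀ {x i j} → X x i → toℕ j ≡ 0 →
          GAdj G' n m k X (inj₁ x) (inj₂ (grid i j))

GEdge : (G' : FinGraph) (n m k : ℕ) →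
        (Fin (FinGraph.size G') → Fin n → Set) →
        GV G' n m k → GV G' n m k → Set
GEdge G' n m k X u v = GAdj G' n m k X u v ⊎ GAdj G' n m k X v u

data InV (G' : FinGraph) {n m k : ℕ} (i : Fin n) : GV G' n m k → Set where
  inGrid : ∀ j → InV G' i (inj₂ (grid i j))
  inPath : ∀ p → InV G' i (inj₂ (path i p))

-- In a treedepth decomposition T, call x "below c" if every vertex of top(T,d)
-- above x is also above c.  Along an edge between two vertices outside
-- top(T,d) this property propagates, and the first vertex of top(T,d) met by
-- a walk that starts below c is itself an ancestor of c.  Column j avoids
-- top(T,d) and is connected, so all its vertices are below the vertex c of
-- row 1 in that column.  Walking inside V_i from (i,j) to a vertex of
-- V_i ∩ top(T,d) therefore yields, for every row i, a vertex w_i ∈ V_i of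
-- top(T,d) that is an ancestor of c.  The w_i are distinct ancestors of a
-- single vertex, so they have distinct depths in {1, …, d}, whence n ≤ d.
module Submission where

open import Defs
open import Data.Nat using (ℕ; _+_; _*_; _≤_)
open import Data.Fin using (Fin)
open import Data.Product using (Σ; ∃; _×_; _,_)
open import Relation.Nullary using (¬_)
open import Data.Sum using (inj₂)

open import Data.Nat using (zero; suc; pred; _<_; z≤n; s≤s; _≤?_)
open import Data.Nat.Properties
  using (≤-reflexive; <-trans; <⇒≤; ≤-trans; <⇒≢)
open import Data.Fin using (zero; suc; toℕ; fromℕ; fromℕ<; inject₁)
open import Data.Fin.Properties using (toℕ-fromℕ; toℕ-fromℕ<; toℕ-inject₁; injective⇒≤)
open import Data.Maybe using (just; nothing)
open import Data.Maybe.Properties using (just-injective)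
open import Data.Product using (proj₁; proj₂)
open import Data.Sum using (_⊎_; inj₁; swap)
open import Data.Empty using (⊥-elim)
open import Function using (_∘_)
open import Function.Definitions using (Injective)
open import Relation.Nullary using (yes; no)
open import Level using (0ℓ)
open import Relation.Binary.Core using (Rel)
open import Relation.Binary.Definitions using (Symmetric)
open import Relation.Binary.PropositionalEquality using (_≡_; refl; sym; trans; cong; subst; module ≡-Reasoning)
open import Relation.Binary.Construct.Closure.ReflexiveTransitive
  using (Star; ε; _◅_; _◅◅_; reverse)

Induced : {V : Set} → (V → Set) → Rel V 0ℓ → Rel V 0ℓ
Induced P E u v = P u × P v × E u v

Induced-sym : {V : Set} {P : V → Set} {E : Rel V 0ℓ} →
              Symmetric E → Symmetric (Induced P E)
Induced-sym E-sym (Pu , Pv , e) = Pv , Pu , E-sym e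

zero-of : ∀ {n} → Fin n → Σ (Fin n) λ z → toℕ z ≡ 0
zero-of zero    = zero , refl
zero-of (suc _) = zero , refl

last-of : ∀ {n} → Fin n → Σ (Fin n) λ l → suc (toℕ l) ≡ n
last-of {suc n} _ = fromℕ n , cong suc (toℕ-fromℕ n)

module _ {V : Set} {R : Rel V 0ℓ} where

  Star-along-Fin : ∀ {n} (u : Fin n → V) →
                   (∀ {a b} → toℕ b ≡ suc (toℕ a) → R (u a) (u b)) →
                   ∀ a b → toℕ a ≡ 0 → Star R (u a) (u b)
  Star-along-Fin u next zero b _ = from-zero u next b
    where
    from-zero : ∀ {n} (u : Fin (suc n) → V) →
                (∀ {a b} → toℕ b ≡ suc (toℕ a) → R (u a) (u b)) →
                ∀ b → Star R (u zero) (u b)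
    from-zero u next zero = ε
    from-zero {suc n} u next (suc b) =
      from-zero (u ∘ inject₁) next′ b ◅◅ next (cong suc (sym (toℕ-inject₁ b))) ◅ ε
      where
      next′ : ∀ {a b} → toℕ b ≡ suc (toℕ a) → R (u (inject₁ a)) (u (inject₁ b))
      next′ {a} {b} e = next (trans (toℕ-inject₁ b) (trans e (cong suc (sym (toℕ-inject₁ a)))))

  Star-between-Fin : ∀ {n} (u : Fin n → V) → Symmetric R →
                     (∀ {a b} → toℕ b ≡ suc (toℕ a) → R (u a) (u b)) →
                     ∀ a b → Star R (u a) (u b)
  Star-between-Fin u R-sym next a b with zero-of a
  ... | z , z≡0 = reverse R-sym (Star-along-Fin u next z a z≡0) ◅◅ Star-along-Fin u next z b z≡0

injective-bounded-positive-≤ : ∀ {n d} (f : Fin n → ℕ) → Injective _≡_ _≡_ f →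
                               (∀ i → 0 < f i) → (∀ i → f i ≤ d) → n ≤ d
injective-bounded-positive-≤ {n} {d} f f-inj f>0 f≤d = injective⇒≤ pred∘f-injective
  where
  pred< : ∀ {x} → 0 < x → x ≤ d → pred x < d
  pred< {suc _} _ x≤d = x≤d

  pred∘f : Fin n → Fin d
  pred∘f i = fromℕ< (pred< (f>0 i) (f≤d i))

  pred∘f-injective : Injective _≡_ _≡_ pred∘f
  pred∘f-injective {i} {i′} e = f-inj (pred-injective (f>0 i) (f>0 i′) (begin
    pred (f i)      ≡⟨ sym (toℕ-fromℕ< (pred< (f>0 i) (f≤d i))) ⟩
    toℕ (pred∘f i)  ≡⟨ cong toℕ e ⟩
    toℕ (pred∘f i′) ≡⟨ toℕ-fromℕ< (pred< (f>0 i′) (f≤d i′)) ⟩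
    pred (f i′)     ∎))
    where
    open ≡-Reasoning
    pred-injective : ∀ {x y} → 0 < x → 0 < y → pred x ≡ pred y → x ≡ y
    pred-injective {suc _} {suc _} _ _ = cong suc

module _ {V : Set} (T : Forest V) where

  Anc⇒depth< : ∀ {u v} → Anc T u v → depth T u < depth T v
  Anc⇒depth< {u} {v} (par p) = ≤-reflexive (sym (depth-child T v u p))
  Anc⇒depth< {v = v} (step {w = w} p a) =
    <-trans (Anc⇒depth< a) (≤-reflexive (sym (depth-child T v w p)))

  Anc-trans : ∀ {u w v} → Anc T u w → Anc T w v → Anc T u v
  Anc-trans a (par p)    = step p a
  Anc-trans a (step p b) = step p (Anc-trans a b)

  Anc-comparable : ∀ {a b x} → Anc T a x → Anc T b x → a ≡ b ⊎ (Anc T a b ⊎ Anc T b a)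
  Anc-comparable (par p) (par q) = inj₁ (just-injective (trans (sym p) q))
  Anc-comparable (par p) (step q b) with just-injective (trans (sym p) q)
  ... | refl = inj₂ (inj₂ b)
  Anc-comparable (step p a) (par q) with just-injective (trans (sym p) q)
  ... | refl = inj₂ (inj₁ a)
  Anc-comparable (step p a) (step q b) with just-injective (trans (sym p) q)
  ... | refl = Anc-comparable a b

  Anc-depth-injective : ∀ {a b x} → Anc T a x → Anc T b x → depth T a ≡ depth T b → a ≡ b
  Anc-depth-injective ax bx da≡db with Anc-comparable ax bx
  ... | inj₁ a≡b       = a≡b
  ... | inj₂ (inj₁ ab) = ⊥-elim (<⇒≢ (Anc⇒depth< ab) da≡db)
  ... | inj₂ (inj₂ ba) = ⊥-elim (<⇒≢ (Anc⇒depth< ba) (sym da≡db))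

  depth-positive : ∀ v → 0 < depth T v
  depth-positive v with parent T v in eq
  ... | nothing = ≤-reflexive (sym (depth-root T v eq))
  ... | just u  = subst (0 <_) (sym (depth-child T v u eq)) (s≤s z≤n)

  injective-top-ancestors-≤ : ∀ {n} d {c} (w : Fin n → V) → Injective _≡_ _≡_ w →
                              (∀ i → Anc T (w i) c) → (∀ i → InTop T d (w i)) → n ≤ d
  injective-top-ancestors-≤ d w w-inj w-anc w-top =
    injective-bounded-positive-≤ (depth T ∘ w)
      (w-inj ∘ Anc-depth-injective (w-anc _) (w-anc _))
      (depth-positive ∘ w) w-top

  Below : ℕ → V → V → Set
  Below d c x = ∀ {a} → InTop T d a → Anc T a x → Anc T a c

module _ {V : Set} {E : Rel V 0ℓ} {T : Forest V} (decomp : IsTDDecomp E T) {d : ℕ} {c : V} where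

  Below-step : ∀ {x y} → E x y → ¬ InTop T d x → Below T d c x → Below T d c y
  Below-step {x} {y} e x∉top x-below {a} a∈top ay with decomp x y e
  ... | inj₂ yx = x-below a∈top (Anc-trans T ay yx)
  ... | inj₁ xy with Anc-comparable T ay xy
  ...   | inj₁ refl       = ⊥-elim (x∉top a∈top)
  ...   | inj₂ (inj₁ ax)  = x-below a∈top ax
  ...   | inj₂ (inj₂ xa)  = ⊥-elim (x∉top (≤-trans (<⇒≤ (Anc⇒depth< T xa)) a∈top))

  Below-first-top : ∀ {x y} → E x y → ¬ InTop T d x → InTop T d y → Below T d c x → Anc T y c
  Below-first-top {x} {y} e x∉top y∈top x-below with decomp x y e
  ... | inj₁ xy = ⊥-elim (x∉top (≤-trans (<⇒≤ (Anc⇒depth< T xy)) y∈top))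
  ... | inj₂ yx = x-below y∈top yx

  Below-along : ∀ {x y} → Star (Induced (λ v → ¬ InTop T d v) E) x y →
                Below T d c x → Below T d c y
  Below-along ε                      x-below = x-below
  Below-along ((x∉top , _ , e) ◅ xs) x-below = Below-along xs (Below-step e x∉top x-below)

  Below-exit : ∀ {P x y} → Star (Induced P E) x y → ¬ InTop T d x → InTop T d y →
               Below T d c x → Σ V λ z → P z × InTop T d z × Anc T z c
  Below-exit ε x∉top x∈top _ = ⊥-elim (x∉top x∈top)
  Below-exit (_◅_ {j = x′} (_ , Px′ , e) xs) x∉top y∈top x-below with depth T x′ ≤? d
  ... | yes x′∈top = x′ , Px′ , x′∈top , Below-first-top e x∉top x′∈top x-below
  ... | no x′∉top  = Below-exit xs x′∉top y∈top (Below-step e x∉top x-below)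

InV-unique : ∀ {G' n m k i i′} {v : GV G' n m k} → InV G' i v → InV G' i′ v → i ≡ i′
InV-unique (inGrid _) (inGrid _) = refl
InV-unique (inPath _) (inPath _) = refl

module _ (G' : FinGraph) {n m k : ℕ} {X : Fin (FinGraph.size G') → Fin n → Set} where

  GEdge-sym : Symmetric (GEdge G' n m k X)
  GEdge-sym = swap

  column-walk : ∀ {P} (j : Fin m) → (∀ i → P (inj₂ (grid i j))) → ∀ i₀ i → toℕ i₀ ≡ 0 →
                Star (Induced P (GEdge G' n m k X)) (inj₂ (grid i₀ j)) (inj₂ (grid i j))
  column-walk j P-column =
    Star-along-Fin (λ i → inj₂ (grid i j)) (λ e → P-column _ , P-column _ , inj₁ (broom (gridE (vert e))))

  row-walk : ∀ i (j j′ : Fin m) →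
             Star (Induced (InV G' i) (GEdge G' n m k X)) (inj₂ (grid i j)) (inj₂ (grid i j′))
  row-walk i = Star-between-Fin (λ j → inj₂ (grid i j)) (Induced-sym {P = InV G' i} GEdge-sym)
                 (λ e → inGrid _ , inGrid _ , inj₁ (broom (gridE (horiz e))))

  InV-walk : ∀ {i} (j : Fin m) {v} → InV G' i v →
             Star (Induced (InV G' i) (GEdge G' n m k X)) (inj₂ (grid i j)) v
  InV-walk j (inGrid j′) = row-walk _ j j′
  InV-walk {i} j (inPath p) with last-of j | zero-of p
  ... | l , l-last | p₀ , p₀≡0 =
    row-walk i j l ◅◅ (inGrid l , inPath p₀ , inj₁ (broom (attach l-last p₀≡0))) ◅
    Star-along-Fin (λ q → inj₂ (path i q)) (λ e → inPath _ , inPath _ , inj₁ (broom (pathE e))) p₀ p p₀≡0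

lemma2 : (n m k : ℕ) → 1 ≤ n → 1 ≤ m → 1 ≤ k →
         (G' : FinGraph) →
         (tdG' tdGrid : ℕ) →
         IsTD (FinGraph.Adj G') tdG' →
         IsTD (GridEdge n m) tdGrid →
         2 * n + tdG' + tdGrid ≤ k →
         (X : Fin (FinGraph.size G') → Fin n → Set) →
         (Σ (Fin (FinGraph.size G')) λ x → Σ (Fin n) λ i → X x i) →
         (T : Forest (GV G' n m k)) →
         Optimal (GEdge G' n m k X) T →
         (d : ℕ) → 1 ≤ d →
         (Σ (Fin m) λ j → ∀ (i : Fin n) →
            ¬ InTop T d (inj₂ (grid i j))) →
         (∀ (i : Fin n) → Σ (GV G' n m k) λ v → InV G' i v × InTop T d v) →
         n ≤ d
lemma2 n m k (s≤s z≤n) _ _ G' _ _ _ _ _ X _ T (decomp , _) d _ (j , column∉top) Vᵢ∩top =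
  injective-top-ancestors-≤ T d w w-injective
    (proj₂ ∘ proj₂ ∘ proj₂ ∘ exit) (proj₁ ∘ proj₂ ∘ proj₂ ∘ exit)
  where
  c : GV G' n m k
  c = inj₂ (grid zero j)

  column-below : ∀ i → Below T d c (inj₂ (grid i j))
  column-below i =
    Below-along decomp (column-walk G' {P = λ v → ¬ InTop T d v} j column∉top zero i refl) (λ _ ac → ac)

  exit : ∀ i → Σ (GV G' n m k) λ z → InV G' i z × InTop T d z × Anc T z c
  exit i with Vᵢ∩top i
  ... | v , v∈Vᵢ , v∈top =
    Below-exit decomp (InV-walk G' j v∈Vᵢ) (column∉top i) v∈top (column-below i)

  w : Fin n → GV G' n m k
  w = proj₁ ∘ exit

  w-injective : Injective _≡_ _≡_ w
  w-injective {i} {i′} wᵢ≡wᵢ′ =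
    InV-unique (proj₁ (proj₂ (exit i))) (subst (InV G' i′) (sym wᵢ≡wᵢ′) (proj₁ (proj₂ (exit i′))))
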